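{- Let $R(x,y,z,s,t)=\sum_{n\ge0}\sum_I x^n y^{a_y(I)}z^{a_z(I)}s^{a_s(I)}t^{a_t(I)}$, where $I$ ranges over independent sets of the graph $G_n$ and $a_c(I)$ is the number of $v\in I$ with $\phi(v,I)=c$. Then \[R=1+x(1+t)R+\frac{x^2y(s+1)(z+1)}{1-x(s+1)(y+1)}R.\]
   Context: $B_n=\{(i,j):1\le i\le j\le n\}$ ($B_0=\emptyset$), with $i$ the row (row 1 on top) and $j$ the column; cells $(i,i)$ form the leading diagonal. $G_n$ (denoted $\mathcal{D}(B_n)\vee\mathcal{UR}(B_{n-1})$ in the paper) is the graph on $B_n$ in which distinct cells $(i,j),(k,\ell)$ are adjacent iff either (a) $i<k$, $j<\ell$ and $\{i,\dots,k\}\times\{j,\dots,\ell\}\subseteq B_n$ (or the same with the cells swapped), or (b) both cells are off the leading diagonal ($i<j$, $k<\ell$) and either $i=k$, or $i>k$ and $j<\ell$ (or the same with the cells swapped). For an independent set $I$ and $v\in I$: $\phi(v,I)=y$ if $v$ is not on the leading diagonal; for $v=(i,i)$, $\phi(v,I)=z$ if $I$ contains another cell in column $i$; otherwise $\phi(v,I)=s$ if $I$ contains a cell $(k,\ell)$ north-east of $v$, i.e. with $k\le i<\ell$; otherwise $\phi(v,I)=t$. The empty set counts as an independent set. -}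

module Defs where

open import Level using (Level)
open import Data.Bool using (Bool; true; false; _∧_; _∨_; not; if_then_else_)
open import Data.Nat using (ℕ; zero; suc; _∸_; _≤ᵇ_; _<ᵇ_; _≡ᵇ_) renaming (_+_ to _+ℕ_)
open import Data.Product using (_×_; _,_)
open import Data.List using (List; []; _∷_; _++_; map; concatMap; upTo; foldr)
open import Data.Bool.ListAction using (all; any)
open import Algebra.Bundles using (CommutativeSemiring)

-- A cell (i , j) : row i, column j.
Cell : Set
Cell = ℕ × ℕ

range : ℕ → ℕ → List ℕ
range a b = map (a +ℕ_) (upTo (suc b ∸ a))

inB : ℕ → Cell → Bool
inB n (r , c) = (1 ≤ᵇ r) ∧ ((r ≤ᵇ c) ∧ (c ≤ᵇ n))

cells : ℕ → List Cell
cells n = concatMap (λ j → map (λ i → (i , j)) (range 1 j)) (range 1 n)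

cellEq : Cell → Cell → Bool
cellEq (i , j) (k , l) = (i ≡ᵇ k) ∧ (j ≡ᵇ l)

rectIn : ℕ → Cell → Cell → Bool
rectIn n (i , j) (k , l) = all (λ r → all (λ c → inB n (r , c)) (range j l)) (range i k)

adjA : ℕ → Cell → Cell → Bool
adjA n (i , j) (k , l) = (i <ᵇ k) ∧ ((j <ᵇ l) ∧ rectIn n (i , j) (k , l))

offDiag : Cell → Bool
offDiag (i , j) = i <ᵇ j

adjB : Cell → Cell → Bool
adjB (i , j) (k , l) = offDiag (i , j) ∧ (offDiag (k , l) ∧ ((i ≡ᵇ k) ∨ ((k <ᵇ i) ∧ (j <ᵇ l))))

adj : ℕ → Cell → Cell → Bool
adj n u v = not (cellEq u v) ∧ (adjA n u v ∨ (adjA n v u ∨ (adjB u v ∨ adjB v u)))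

independent : ℕ → List Cell → Bool
independent n I = all (λ u → all (λ v → not (adj n u v)) I) I

-- all sub-lists (= all subsets, as cells n is duplicate-free)
subsets : {A : Set} → List A → List (List A)
subsets [] = [] ∷ []
subsets (x ∷ xs) = subsets xs ++ map (x ∷_) (subsets xs)

data Label : Set where
  ly lz ls lt : Label

phi : List Cell → Cell → Label
phi I (i , j) =
  if i <ᵇ j then ly
  else if any (λ { (k , l) → (l ≡ᵇ i) ∧ not (k ≡ᵇ i) }) I then lz
  else if any (λ { (k , l) → (k ≤ᵇ i) ∧ (i <ᵇ l) }) I then ls
  else lt

module GF {c ℓ : Level} (S : CommutativeSemiring c ℓ) (y z s t : CommutativeSemiring.Carrier S) where
  open CommutativeSemiring S

  sumS : List Carrier → Carrier
  sumS = foldr _+_ 0#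

  prodS : List Carrier → Carrier
  prodS = foldr _*_ 1#

  pow : Carrier → ℕ → Carrier
  pow a zero = 1#
  pow a (suc m) = a * pow a m

  val : Label → Carrier
  val ly = y
  val lz = z
  val ls = s
  val lt = t

  weight : List Cell → Carrier
  weight I = prodS (map (λ v → val (phi I v)) I)

  -- R_n = [x^n] R = Σ over independent sets I of G_n of weight I
  Rn : ℕ → Carrier
  Rn n = sumS (map (λ I → if independent n I then weight I else 0#) (subsets (cells n)))

  -- [x^n] of  1 + x(1+t)R + x^2 y(s+1)(z+1) (Σ_{m≥0} x^m ((s+1)(y+1))^m) R
  rhsCoeff : ℕ → Carrier
  rhsCoeff zero = 1#
  rhsCoeff (suc m) =
    ((1# + t) * Rn m)
    + sumS (map (λ k → ((y * (s + 1#)) * (z + 1#)) * (pow ((s + 1#) * (y + 1#)) (k ∸ 2) * Rn (suc m ∸ k)))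
                (range 2 (suc m)))

module Submission where

-- Diagonal cells are isolated in G_n and their labels depend only on the off-diagonal cells of I, so
-- summing them out turns R_n into Q_n = Σ_J y^|J| ∏_i (φ((i,i), J) + 1), the sum over independent sets J
-- of off-diagonal cells of B_n. For n = m + 1 split J according to its cells in the last column. If
-- there are none, (n , n) gets label t and the contribution is (1 + t) Q_m. Otherwise let (p + 1 , n)
-- be the topmost one: it is adjacent to every off-diagonal cell in the columns p + 1, …, m and to none
-- in the columns ≤ p, the cells of column n below it are unconstrained, and the diagonal cells (i , i)
-- get label s for p < i < n and z for i = n. With k = m − p − 1 this contributes
-- y (s + 1)^(k + 1) (z + 1) (y + 1)^k Q_p, which is the coefficient of x^n in
-- x² y (s + 1)(z + 1) (x (s + 1)(y + 1))^k x^p R.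

open import Defs
open import Level using (Level; 0ℓ)
open import Algebra.Bundles using (CommutativeSemiring)
open import Data.Bool using (Bool; true; false; _∧_; _∨_; not; T; if_then_else_)
open import Data.Bool.Properties using (¬-not; not-¬; ⇔→≡; T?; ∧-zeroʳ; ∧-inverseʳ; ∨-zeroʳ)
open import Data.Bool.ListAction using (all; any)
open import Data.Empty using (⊥-elim)
open import Data.Nat using (ℕ; zero; suc; _∸_; _≤ᵇ_; _<ᵇ_; _≡ᵇ_; _≤_; _<_; z≤n; s≤s)
  renaming (_+_ to _+ℕ_)
import Data.Nat.Properties as ℕₚ
open import Data.Product using (_×_; _,_; proj₁; proj₂)
open import Data.Sum using (_⊎_; inj₁; inj₂; [_,_])
open import Data.List using (List; []; _∷_; _++_; map; foldr; upTo; applyUpTo; concatMap; filter)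
open import Data.List.Properties
  using (++-assoc; ++-identityʳ; map-++; map-∘; map-upTo; upTo-∷ʳ; concatMap-++;
         filter-++; filter-all; filter-none; filter-accept; filter-reject)
open import Data.List.Relation.Unary.All as All using (All; []; _∷_)
import Data.List.Relation.Unary.All.Properties as Allₚ
open import Data.List.Relation.Unary.Any using (here; there)
open import Data.List.Membership.Propositional using (_∈_)
open import Data.List.Membership.Propositional.Properties
  using (∈-map⁻; ∈-map⁺; ∈-upTo⁺; ∈-upTo⁻; ∈-filter⁺; ∈-filter⁻; ∈-++⁺ˡ; ∈-++⁺ʳ; ∈-++⁻)
open import Function.Base using (_∘_)
open import Function.Bundles using (mk⇔)
open import Relation.Binary.Definitions using (Tri; tri<; tri≈; tri>)
open import Relation.Binary.PropositionalEquality
  using (_≡_; _≢_; refl; sym; trans; cong; cong₂; subst; module ≡-Reasoning)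
open import Relation.Nullary using (¬_; Dec; yes; no)
open import Relation.Unary using (Pred; Decidable; ∁)
open import Relation.Unary.Properties using (∁?)

T⇒≡true : ∀ {b} → T b → b ≡ true
T⇒≡true {true} _ = refl

≡true⇒T : ∀ {b} → b ≡ true → T b
≡true⇒T refl = _

¬T⇒≡false : ∀ {b} → ¬ T b → b ≡ false
¬T⇒≡false {false} _ = refl
¬T⇒≡false {true} ¬t = ⊥-elim (¬t _)

∧-true⁻ : ∀ {a b} → a ∧ b ≡ true → a ≡ true × b ≡ true
∧-true⁻ {true} {true} _ = refl , refl

∨-true⁻ : ∀ {a b} → a ∨ b ≡ true → a ≡ true ⊎ b ≡ true
∨-true⁻ {true} _ = inj₁ refl
∨-true⁻ {false} e = inj₂ e

not-true⁻ : ∀ {b} → not b ≡ true → b ≡ false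
not-true⁻ {false} _ = refl

<⇒<ᵇ≡true : ∀ {m n} → m < n → (m <ᵇ n) ≡ true
<⇒<ᵇ≡true m<n = T⇒≡true (ℕₚ.<⇒<ᵇ m<n)

<ᵇ≡true⇒< : ∀ {m n} → (m <ᵇ n) ≡ true → m < n
<ᵇ≡true⇒< {m} {n} e = ℕₚ.<ᵇ⇒< m n (≡true⇒T e)

≤⇒<ᵇ≡false : ∀ {m n} → n ≤ m → (m <ᵇ n) ≡ false
≤⇒<ᵇ≡false n≤m = ¬-not (λ e → ℕₚ.<⇒≱ (<ᵇ≡true⇒< e) n≤m)

<ᵇ≡false⇒≤ : ∀ {m n} → (m <ᵇ n) ≡ false → n ≤ m
<ᵇ≡false⇒≤ e = ℕₚ.≮⇒≥ (λ m<n → not-¬ (<⇒<ᵇ≡true m<n) e)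

<ᵇ-irrefl : ∀ n → (n <ᵇ n) ≡ false
<ᵇ-irrefl n = ≤⇒<ᵇ≡false {n} ℕₚ.≤-refl

≤⇒≤ᵇ≡true : ∀ {m n} → m ≤ n → (m ≤ᵇ n) ≡ true
≤⇒≤ᵇ≡true m≤n = T⇒≡true (ℕₚ.≤⇒≤ᵇ m≤n)

≤ᵇ≡true⇒≤ : ∀ {m n} → (m ≤ᵇ n) ≡ true → m ≤ n
≤ᵇ≡true⇒≤ {m} {n} e = ℕₚ.≤ᵇ⇒≤ m n (≡true⇒T e)

<⇒≤ᵇ≡false : ∀ {m n} → n < m → (m ≤ᵇ n) ≡ false
<⇒≤ᵇ≡false n<m = ¬-not (λ e → ℕₚ.<⇒≱ n<m (≤ᵇ≡true⇒≤ e))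

≡ᵇ-refl : ∀ n → (n ≡ᵇ n) ≡ true
≡ᵇ-refl n = T⇒≡true (ℕₚ.≡⇒≡ᵇ n n refl)

≡ᵇ≡true⇒≡ : ∀ {m n} → (m ≡ᵇ n) ≡ true → m ≡ n
≡ᵇ≡true⇒≡ {m} {n} e = ℕₚ.≡ᵇ⇒≡ m n (≡true⇒T e)

≢⇒≡ᵇ≡false : ∀ {m n} → m ≢ n → (m ≡ᵇ n) ≡ false
≢⇒≡ᵇ≡false m≢n = ¬-not (λ e → m≢n (≡ᵇ≡true⇒≡ e))

≡ᵇ-sym : ∀ m n → (m ≡ᵇ n) ≡ (n ≡ᵇ m)
≡ᵇ-sym m n = ⇔→≡ (mk⇔ (λ e → swapped (≡ᵇ≡true⇒≡ {m} e)) (λ e → swapped (≡ᵇ≡true⇒≡ {n} e)))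
  where
    swapped : ∀ {a b} → a ≡ b → (b ≡ᵇ a) ≡ true
    swapped {a} refl = ≡ᵇ-refl a

∈-range⁻ : ∀ {a b x} → x ∈ range a b → a ≤ x × x ≤ b
∈-range⁻ {a} {b} x∈ with ∈-map⁻ (a +ℕ_) x∈
... | i , i∈ , refl = ℕₚ.m≤m+n a i , ℕₚ.≤-pred (begin-strict
  a +ℕ i            <⟨ ℕₚ.+-monoʳ-< a (∈-upTo⁻ i∈) ⟩
  a +ℕ (suc b ∸ a)  ≡⟨ ℕₚ.m+[n∸m]≡n a≤1+b ⟩
  suc b             ∎)
  where
    open ℕₚ.≤-Reasoning
    a≤1+b : a ≤ suc b
    a≤1+b = ℕₚ.≮⇒≥ λ 1+b<a →
      ℕₚ.n≮0 (subst (i <_) (ℕₚ.m≤n⇒m∸n≡0 (ℕₚ.<⇒≤ 1+b<a)) (∈-upTo⁻ i∈))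

∈-range⁺ : ∀ {a b x} → a ≤ x → x ≤ b → x ∈ range a b
∈-range⁺ {a} {b} a≤x x≤b = subst (_∈ range a b) (ℕₚ.m+[n∸m]≡n a≤x)
  (∈-map⁺ (a +ℕ_) (∈-upTo⁺ (ℕₚ.∸-monoˡ-< (s≤s x≤b) a≤x)))

module _ {A : Set} {p : A → Bool} where

  all-true⁻ : ∀ {xs x} → all p xs ≡ true → x ∈ xs → p x ≡ true
  all-true⁻ {x ∷ _} e (here refl) = proj₁ (∧-true⁻ {p x} e)
  all-true⁻ {y ∷ _} e (there x∈) = all-true⁻ (proj₂ (∧-true⁻ {p y} e)) x∈

  all-true⁺ : ∀ {xs} → (∀ {x} → x ∈ xs → p x ≡ true) → all p xs ≡ true
  all-true⁺ {[]} h = refl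
  all-true⁺ {x ∷ xs} h rewrite h (here refl) = all-true⁺ (λ x∈ → h (there x∈))

  any-true⁺ : ∀ {xs x} → x ∈ xs → p x ≡ true → any p xs ≡ true
  any-true⁺ {x ∷ _} (here refl) e rewrite e = refl
  any-true⁺ {y ∷ _} (there x∈) e rewrite any-true⁺ x∈ e = ∨-zeroʳ (p y)

  any-false⁺ : ∀ {xs} → (∀ {x} → x ∈ xs → p x ≡ false) → any p xs ≡ false
  any-false⁺ {[]} h = refl
  any-false⁺ {x ∷ xs} h rewrite h (here refl) = any-false⁺ (λ x∈ → h (there x∈))

  any-++-false : ∀ xs {ys} → any p ys ≡ false → any p (xs ++ ys) ≡ any p xs
  any-++-false [] e = e
  any-++-false (x ∷ xs) e = cong (p x ∨_) (any-++-false xs e)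

all-cong : ∀ {A : Set} {p q : A → Bool} {xs} → (∀ {x} → x ∈ xs → p x ≡ q x) → all p xs ≡ all q xs
all-cong {xs = []} h = refl
all-cong {xs = x ∷ xs} h = cong₂ _∧_ (h (here refl)) (all-cong (λ x∈ → h (there x∈)))

any-filter : ∀ {A : Set} {P : Pred A 0ℓ} (P? : Decidable P) (p : A → Bool) {xs} →
             All (λ x → ¬ P x → p x ≡ false) xs → any p (filter P? xs) ≡ any p xs
any-filter P? p [] = refl
any-filter P? p {x ∷ _} (h ∷ hs) with P? x
... | yes _ = cong (p x ∨_) (any-filter P? p hs)
... | no ¬px rewrite h ¬px = any-filter P? p hs

-- Adjacency in G_n

rectIn-corner : ∀ n {i j k l} → i ≤ k → j ≤ l → rectIn n (i , j) (k , l) ≡ true → k ≤ j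
rectIn-corner n {i} {j} {k} {l} i≤k j≤l e =
  let kj∈B = all-true⁻ (all-true⁻ {xs = range i k} e (∈-range⁺ i≤k ℕₚ.≤-refl)) (∈-range⁺ ℕₚ.≤-refl j≤l)
  in ≤ᵇ≡true⇒≤ (proj₁ (∧-true⁻ (proj₂ (∧-true⁻ {1 ≤ᵇ k} kj∈B))))

rectIn-full : ∀ n {i j k l} → 1 ≤ i → k ≤ j → l ≤ n → rectIn n (i , j) (k , l) ≡ true
rectIn-full n 1≤i k≤j l≤n = all-true⁺ λ r∈ → all-true⁺ λ c∈ →
  let i≤r , r≤k = ∈-range⁻ r∈
      j≤c , c≤l = ∈-range⁻ c∈
  in cong₂ _∧_ (≤⇒≤ᵇ≡true (ℕₚ.≤-trans 1≤i i≤r))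
       (cong₂ _∧_ (≤⇒≤ᵇ≡true (ℕₚ.≤-trans r≤k (ℕₚ.≤-trans k≤j j≤c)))
                  (≤⇒≤ᵇ≡true (ℕₚ.≤-trans c≤l l≤n)))

inB-restrict : ∀ {n p r c} → c ≤ p → p ≤ n → inB n (r , c) ≡ inB p (r , c)
inB-restrict {r = r} {c} c≤p p≤n = cong (λ b → (1 ≤ᵇ r) ∧ ((r ≤ᵇ c) ∧ b))
  (trans (≤⇒≤ᵇ≡true (ℕₚ.≤-trans c≤p p≤n)) (sym (≤⇒≤ᵇ≡true c≤p)))

rectIn-restrict : ∀ {n p i j k l} → l ≤ p → p ≤ n → rectIn n (i , j) (k , l) ≡ rectIn p (i , j) (k , l)
rectIn-restrict {i = i} {j} {k} {l} l≤p p≤n =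
  all-cong {xs = range i k} λ {r} _ → all-cong {xs = range j l} λ c∈ →
    inB-restrict {r = r} (ℕₚ.≤-trans (proj₂ (∈-range⁻ c∈)) l≤p) p≤n

adjA⁻ : ∀ n i j k l → adjA n (i , j) (k , l) ≡ true → i < k × j < l × k ≤ j
adjA⁻ n i j k l e =
  let i<k , e′ = ∧-true⁻ {i <ᵇ k} e
      j<l , inside = ∧-true⁻ {j <ᵇ l} e′
  in <ᵇ≡true⇒< i<k , <ᵇ≡true⇒< j<l ,
     rectIn-corner n (ℕₚ.<⇒≤ (<ᵇ≡true⇒< i<k)) (ℕₚ.<⇒≤ (<ᵇ≡true⇒< j<l)) inside

adjA⁺ : ∀ n {i j k l} → 1 ≤ i → i < k → j < l → k ≤ j → l ≤ n → adjA n (i , j) (k , l) ≡ true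
adjA⁺ n 1≤i i<k j<l k≤j l≤n rewrite <⇒<ᵇ≡true i<k | <⇒<ᵇ≡true j<l = rectIn-full n 1≤i k≤j l≤n

adjA-restrict : ∀ {n p i j k l} → l ≤ p → p ≤ n → adjA n (i , j) (k , l) ≡ adjA p (i , j) (k , l)
adjA-restrict {n} {p} {i} {j} {k} {l} l≤p p≤n =
  cong (λ b → (i <ᵇ k) ∧ ((j <ᵇ l) ∧ b)) (rectIn-restrict {n} {p} {i} {j} {k} {l} l≤p p≤n)

adjB⁻ : ∀ i j k l → adjB (i , j) (k , l) ≡ true → i < j × k < l × (i ≡ k ⊎ k < i × j < l)
adjB⁻ i j k l e =
  let i<j , e′ = ∧-true⁻ {i <ᵇ j} e
      k<l , rel = ∧-true⁻ {k <ᵇ l} e′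
  in <ᵇ≡true⇒< i<j , <ᵇ≡true⇒< k<l , relation (∨-true⁻ {i ≡ᵇ k} rel)
  where
    relation : (i ≡ᵇ k) ≡ true ⊎ ((k <ᵇ i) ∧ (j <ᵇ l)) ≡ true → i ≡ k ⊎ k < i × j < l
    relation (inj₁ i≡k) = inj₁ (≡ᵇ≡true⇒≡ i≡k)
    relation (inj₂ e) = let k<i , j<l = ∧-true⁻ {k <ᵇ i} e in inj₂ (<ᵇ≡true⇒< k<i , <ᵇ≡true⇒< j<l)

adjB-sameRow : ∀ {i j l} → i < j → i < l → adjB (i , j) (i , l) ≡ true
adjB-sameRow {i} i<j i<l rewrite <⇒<ᵇ≡true i<j | <⇒<ᵇ≡true i<l | ≡ᵇ-refl i = refl

adjB-northEast : ∀ {i j k l} → i < j → k < l → k < i → j < l → adjB (i , j) (k , l) ≡ true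
adjB-northEast {i} {k = k} i<j k<l k<i j<l
  rewrite <⇒<ᵇ≡true i<j | <⇒<ᵇ≡true k<l | <⇒<ᵇ≡true k<i | <⇒<ᵇ≡true j<l = ∨-zeroʳ (i ≡ᵇ k)

adj-false : ∀ n u v → ¬ adjA n u v ≡ true → ¬ adjA n v u ≡ true → ¬ adjB u v ≡ true → ¬ adjB v u ≡ true →
            adj n u v ≡ false
adj-false n u v ¬uv ¬vu ¬uvᴮ ¬vuᴮ
  rewrite ¬-not ¬uv | ¬-not ¬vu | ¬-not ¬uvᴮ | ¬-not ¬vuᴮ = ∧-zeroʳ (not (cellEq u v))

adj-true : ∀ n u v → cellEq u v ≡ false → adjA n u v ≡ true ⊎ adjB u v ≡ true → adj n u v ≡ true
adj-true n u v u≢v (inj₁ uv) rewrite u≢v | uv = refl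
adj-true n u v u≢v (inj₂ uvᴮ) rewrite u≢v | uvᴮ | ∨-zeroʳ (adjA n v u) = ∨-zeroʳ (adjA n u v)

adj-irrefl : ∀ n u → adj n u u ≡ false
adj-irrefl n (i , j) rewrite ≡ᵇ-refl i | ≡ᵇ-refl j = refl

adj-sym : ∀ n u v → adj n u v ≡ adj n v u
adj-sym n u v =
  cong₂ (λ e a → not e ∧ a) (cellEq-sym u v) (swap (adjA n u v) (adjA n v u) (adjB u v) (adjB v u))
  where
    cellEq-sym : ∀ u v → cellEq u v ≡ cellEq v u
    cellEq-sym (i , j) (k , l) = cong₂ _∧_ (≡ᵇ-sym i k) (≡ᵇ-sym j l)

    swap : ∀ a b c d → (a ∨ (b ∨ (c ∨ d))) ≡ (b ∨ (a ∨ (d ∨ c)))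
    swap true true _ _ = refl
    swap true false _ _ = refl
    swap false true _ _ = refl
    swap false false true true = refl
    swap false false true false = refl
    swap false false false true = refl
    swap false false false false = refl

adj-restrict : ∀ {n p i j k l} → j ≤ p → l ≤ p → p ≤ n → adj n (i , j) (k , l) ≡ adj p (i , j) (k , l)
adj-restrict {n} {p} {i} {j} {k} {l} j≤p l≤p p≤n
  rewrite adjA-restrict {n} {p} {i} {j} {k} {l} l≤p p≤n | adjA-restrict {n} {p} {k} {l} {i} {j} j≤p p≤n
  = refl

adj-¬offDiag : ∀ n {u} v → offDiag u ≡ false → adj n u v ≡ false
adj-¬offDiag n {i , j} (k , l) e = adj-false n (i , j) (k , l)
  (λ x → let i<k , _ , k≤j = adjA⁻ n i j k l x in ℕₚ.<⇒≱ i<k (ℕₚ.≤-trans k≤j j≤i))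
  (λ x → let _ , l<j , i≤l = adjA⁻ n k l i j x in ℕₚ.<⇒≱ l<j (ℕₚ.≤-trans j≤i i≤l))
  (λ x → ℕₚ.<⇒≱ (proj₁ (adjB⁻ i j k l x)) j≤i)
  (λ x → ℕₚ.<⇒≱ (proj₁ (proj₂ (adjB⁻ k l i j x))) j≤i)
  where j≤i = <ᵇ≡false⇒≤ e

adj-column<row : ∀ n {a b q l} → a ≤ b → b < q → q ≤ l → adj n (a , b) (q , l) ≡ false
adj-column<row n {a} {b} {q} {l} a≤b b<q q≤l = adj-false n (a , b) (q , l)
  (λ x → let _ , _ , q≤b = adjA⁻ n a b q l x in ℕₚ.<⇒≱ b<q q≤b)
  (λ x → let _ , l<b , _ = adjA⁻ n q l a b x in ℕₚ.<⇒≱ l<b b≤l)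
  (λ x → [ a≢q , (λ (q<a , _) → ℕₚ.<⇒≱ q<a (ℕₚ.<⇒≤ a<q)) ] (proj₂ (proj₂ (adjB⁻ a b q l x))))
  (λ x → [ (λ q≡a → a≢q (sym q≡a)) , (λ (_ , l<b) → ℕₚ.<⇒≱ l<b b≤l) ] (proj₂ (proj₂ (adjB⁻ q l a b x))))
  where
    a<q = ℕₚ.≤-<-trans a≤b b<q
    a≢q = ℕₚ.<⇒≢ a<q
    b≤l = ℕₚ.≤-trans (ℕₚ.<⇒≤ b<q) q≤l

adj-sameColumn : ∀ n q q′ l → adj n (q , l) (q′ , l) ≡ false
adj-sameColumn n q q′ l with q ℕₚ.≟ q′
... | yes refl = adj-irrefl n (q , l)
... | no q≢q′ = adj-false n (q , l) (q′ , l)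
  (λ x → ℕₚ.<-irrefl refl (proj₁ (proj₂ (adjA⁻ n q l q′ l x))))
  (λ x → ℕₚ.<-irrefl refl (proj₁ (proj₂ (adjA⁻ n q′ l q l x))))
  (λ x → [ q≢q′ , (λ (_ , l<l) → ℕₚ.<-irrefl refl l<l) ] (proj₂ (proj₂ (adjB⁻ q l q′ l x))))
  (λ x → [ (λ e → q≢q′ (sym e)) , (λ (_ , l<l) → ℕₚ.<-irrefl refl l<l) ] (proj₂ (proj₂ (adjB⁻ q′ l q l x))))

adj-spanned : ∀ {a b r n} → 1 ≤ a → a < b → r ≤ b → b < n → adj n (a , b) (r , n) ≡ true
adj-spanned {a} {b} {r} {n} 1≤a a<b r≤b b<n = adj-true n (a , b) (r , n) distinct (related (ℕₚ.<-cmp a r))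
  where
    distinct : cellEq (a , b) (r , n) ≡ false
    distinct rewrite ≢⇒≡ᵇ≡false (ℕₚ.<⇒≢ b<n) = ∧-zeroʳ (a ≡ᵇ r)
    r<n = ℕₚ.≤-<-trans r≤b b<n
    related : Tri (a < r) (a ≡ r) (r < a) → adjA n (a , b) (r , n) ≡ true ⊎ adjB (a , b) (r , n) ≡ true
    related (tri< a<r _ _) = inj₁ (adjA⁺ n 1≤a a<r b<n r≤b ℕₚ.≤-refl)
    related (tri≈ _ refl _) = inj₂ (adjB-sameRow a<b r<n)
    related (tri> _ _ r<a) = inj₂ (adjB-northEast a<b r<n r<a b<n)

independent⁻ : ∀ n I {u v} → independent n I ≡ true → u ∈ I → v ∈ I → adj n u v ≡ false
independent⁻ n I e u∈ v∈ = not-true⁻ (all-true⁻ (all-true⁻ {xs = I} e u∈) v∈)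

independent⁺ : ∀ n I → (∀ {u v} → u ∈ I → v ∈ I → adj n u v ≡ false) → independent n I ≡ true
independent⁺ n I h = all-true⁺ λ u∈ → all-true⁺ λ v∈ → cong not (h u∈ v∈)

-- Cells of B_n

offDiag? : Decidable (T ∘ offDiag)
offDiag? v = T? (offDiag v)

onDiag? : Decidable (∁ (T ∘ offDiag))
onDiag? = ∁? offDiag?

Upper : Cell → Set
Upper (k , l) = k ≤ l

upper-¬offDiag⇒diagonal : ∀ {k l} → Upper (k , l) → ¬ T (offDiag (k , l)) → k ≡ l
upper-¬offDiag⇒diagonal k≤l ¬k<l = ℕₚ.≤-antisym k≤l (<ᵇ≡false⇒≤ (¬T⇒≡false ¬k<l))

colCells : ℕ → ℕ → ℕ → List Cell
colCells a zero j = []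
colCells a (suc c) j = (a , j) ∷ colCells (suc a) c j

-- the off-diagonal cells of B_(p + d) in the columns p + 1, …, p + d
offDiagBetween : ℕ → ℕ → List Cell
offDiagBetween p zero = []
offDiagBetween p (suc d) = offDiagBetween p d ++ colCells 1 (p +ℕ d) (suc (p +ℕ d))

offDiagCells : ℕ → List Cell
offDiagCells = offDiagBetween 0

diagFrom : ℕ → ℕ → List Cell
diagFrom a zero = []
diagFrom a (suc d) = (a , a) ∷ diagFrom (suc a) d

diagCells : ℕ → List Cell
diagCells = diagFrom 1

colCells-∷ʳ : ∀ a c j → colCells a (suc c) j ≡ colCells a c j ++ (a +ℕ c , j) ∷ []
colCells-∷ʳ a zero j = cong (λ x → (x , j) ∷ []) (sym (ℕₚ.+-identityʳ a))
colCells-∷ʳ a (suc c) j = cong ((a , j) ∷_) (trans (colCells-∷ʳ (suc a) c j)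
  (cong (λ x → colCells (suc a) c j ++ (x , j) ∷ []) (sym (ℕₚ.+-suc a c))))

diagFrom-++ : ∀ a c d → diagFrom a (c +ℕ d) ≡ diagFrom a c ++ diagFrom (a +ℕ c) d
diagFrom-++ a zero d = cong (λ x → diagFrom x d) (sym (ℕₚ.+-identityʳ a))
diagFrom-++ a (suc c) d = cong ((a , a) ∷_) (trans (diagFrom-++ (suc a) c d)
  (cong (λ x → diagFrom (suc a) c ++ diagFrom x d) (sym (ℕₚ.+-suc a c))))

diagCells-∷ʳ : ∀ m → diagCells (suc m) ≡ diagCells m ++ (suc m , suc m) ∷ []
diagCells-∷ʳ m = trans (cong (diagFrom 1) (ℕₚ.+-comm 1 m)) (diagFrom-++ 1 m 1)

offDiagBetween-++ : ∀ p d → offDiagCells (p +ℕ d) ≡ offDiagCells p ++ offDiagBetween p d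
offDiagBetween-++ p zero = trans (cong offDiagCells (ℕₚ.+-identityʳ p)) (sym (++-identityʳ _))
offDiagBetween-++ p (suc d) rewrite ℕₚ.+-suc p d | offDiagBetween-++ p d =
  ++-assoc (offDiagCells p) (offDiagBetween p d) _

cells-suc : ∀ m → cells (suc m) ≡ cells m ++ colCells 1 (suc m) (suc m)
cells-suc m = begin
  concatMap column (range 1 (suc m))            ≡⟨ cong (concatMap column) range-∷ʳ ⟩
  concatMap column (range 1 m ++ suc m ∷ [])    ≡⟨ concatMap-++ column (range 1 m) (suc m ∷ []) ⟩
  cells m ++ column (suc m) ++ []               ≡⟨ cong (cells m ++_) (++-identityʳ _) ⟩
  cells m ++ column (suc m)                     ≡⟨ cong (cells m ++_) (column≡colCells (suc m)) ⟩
  cells m ++ colCells 1 (suc m) (suc m)         ∎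
  where
    open ≡-Reasoning
    column : ℕ → List Cell
    column j = map (λ i → (i , j)) (range 1 j)
    range-∷ʳ : range 1 (suc m) ≡ range 1 m ++ suc m ∷ []
    range-∷ʳ = trans (cong (map suc) (sym (upTo-∷ʳ m))) (map-++ suc (upTo m) (m ∷ []))
    applyUpTo≡colCells : ∀ {f : ℕ → Cell} a c j → (∀ i → f i ≡ (a +ℕ i , j)) → applyUpTo f c ≡ colCells a c j
    applyUpTo≡colCells a zero j h = refl
    applyUpTo≡colCells a (suc c) j h = cong₂ _∷_ (trans (h 0) (cong (_, j) (ℕₚ.+-identityʳ a)))
      (applyUpTo≡colCells (suc a) c j (λ i → trans (h (suc i)) (cong (_, j) (ℕₚ.+-suc a i))))
    column≡colCells : ∀ j → column j ≡ colCells 1 j j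
    column≡colCells j =
      trans (sym (map-∘ (upTo j))) (trans (map-upTo _ j) (applyUpTo≡colCells 1 j j (λ _ → refl)))

interval-tail : ∀ {ℓ} {P : ℕ → Set ℓ} a d → (∀ {i} → a ≤ i → i < a +ℕ suc d → P i) →
                ∀ {i} → suc a ≤ i → i < suc a +ℕ d → P i
interval-tail a d h {i} a<i i< = h (ℕₚ.<⇒≤ a<i) (subst (i <_) (sym (ℕₚ.+-suc a d)) i<)

colCells-All : ∀ {P : Cell → Set} a c j → (∀ {q} → a ≤ q → q < a +ℕ c → P (q , j)) → All P (colCells a c j)
colCells-All a zero j h = []
colCells-All a (suc c) j h =
  h ℕₚ.≤-refl (ℕₚ.m<m+n a (s≤s z≤n)) ∷ colCells-All (suc a) c j (interval-tail a c h)

column-offDiag : ∀ m → All (T ∘ offDiag) (colCells 1 m (suc m))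
column-offDiag m = colCells-All 1 m (suc m) (λ _ q<1+m → ℕₚ.<⇒<ᵇ q<1+m)

filter-offDiag-cells : ∀ n → filter offDiag? (cells n) ≡ offDiagCells n
filter-offDiag-cells zero = refl
filter-offDiag-cells (suc m) = begin
  filter offDiag? (cells (suc m))
    ≡⟨ cong (filter offDiag?) (trans (cells-suc m) (cong (cells m ++_) (colCells-∷ʳ 1 m (suc m)))) ⟩
  filter offDiag? (cells m ++ colCells 1 m (suc m) ++ (suc m , suc m) ∷ [])
    ≡⟨ filter-++ offDiag? (cells m) _ ⟩
  filter offDiag? (cells m) ++ filter offDiag? (colCells 1 m (suc m) ++ (suc m , suc m) ∷ [])
    ≡⟨ cong₂ _++_ (filter-offDiag-cells m) (filter-++ offDiag? (colCells 1 m (suc m)) _) ⟩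
  offDiagCells m ++ filter offDiag? (colCells 1 m (suc m)) ++ filter offDiag? ((suc m , suc m) ∷ [])
    ≡⟨ cong₂ (λ xs ys → offDiagCells m ++ xs ++ ys)
             (filter-all offDiag? (column-offDiag m)) (diagonal-rejected (suc m)) ⟩
  offDiagCells m ++ colCells 1 m (suc m) ++ []
    ≡⟨ cong (offDiagCells m ++_) (++-identityʳ _) ⟩
  offDiagCells (suc m) ∎
  where
    open ≡-Reasoning
    diagonal-rejected : ∀ k → filter offDiag? ((k , k) ∷ []) ≡ []
    diagonal-rejected k rewrite <ᵇ-irrefl k = refl

filter-onDiag-cells : ∀ n → filter onDiag? (cells n) ≡ diagCells n
filter-onDiag-cells zero = refl
filter-onDiag-cells (suc m) = begin
  filter onDiag? (cells (suc m))
    ≡⟨ cong (filter onDiag?) (trans (cells-suc m) (cong (cells m ++_) (colCells-∷ʳ 1 m (suc m)))) ⟩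
  filter onDiag? (cells m ++ colCells 1 m (suc m) ++ (suc m , suc m) ∷ [])
    ≡⟨ filter-++ onDiag? (cells m) _ ⟩
  filter onDiag? (cells m) ++ filter onDiag? (colCells 1 m (suc m) ++ (suc m , suc m) ∷ [])
    ≡⟨ cong₂ _++_ (filter-onDiag-cells m) (filter-++ onDiag? (colCells 1 m (suc m)) _) ⟩
  diagCells m ++ filter onDiag? (colCells 1 m (suc m)) ++ filter onDiag? ((suc m , suc m) ∷ [])
    ≡⟨ cong₂ (λ xs ys → diagCells m ++ xs ++ ys)
             (filter-none onDiag? (All.map (λ t ¬t → ¬t t) (column-offDiag m))) (diagonal-accepted (suc m)) ⟩
  diagCells m ++ (suc m , suc m) ∷ []
    ≡⟨ diagCells-∷ʳ m ⟨
  diagCells (suc m) ∎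
  where
    open ≡-Reasoning
    diagonal-accepted : ∀ k → filter onDiag? ((k , k) ∷ []) ≡ (k , k) ∷ []
    diagonal-accepted k rewrite <ᵇ-irrefl k = refl

cells-Upper : ∀ n → All Upper (cells n)
cells-Upper zero = []
cells-Upper (suc m) rewrite cells-suc m =
  Allₚ.++⁺ (cells-Upper m) (colCells-All 1 (suc m) (suc m) (λ _ q<2+m → ℕₚ.≤-pred q<2+m))

OffDiagIn : ℕ → ℕ → Cell → Set
OffDiagIn p m (a , b) = 1 ≤ a × a < b × p < b × b ≤ m

offDiagBetween-All : ∀ p d → All (OffDiagIn p (p +ℕ d)) (offDiagBetween p d)
offDiagBetween-All p zero = []
offDiagBetween-All p (suc d) = Allₚ.++⁺ (All.map widen (offDiagBetween-All p d))
  (colCells-All 1 (p +ℕ d) (suc (p +ℕ d)) λ 1≤q q< →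
    1≤q , q< , s≤s (ℕₚ.m≤m+n p d) , ℕₚ.≤-reflexive (sym (ℕₚ.+-suc p d)))
  where
    widen : ∀ {v} → OffDiagIn p (p +ℕ d) v → OffDiagIn p (p +ℕ suc d) v
    widen (1≤a , a<b , p<b , b≤) = 1≤a , a<b , p<b , ℕₚ.≤-trans b≤ (ℕₚ.+-monoʳ-≤ p (ℕₚ.n≤1+n d))

InColumnBelow : ℕ → ℕ → Cell → Set
InColumnBelow p n (q , l) = l ≡ n × p < q × q < n

independent-filter-offDiag : ∀ n I → independent n I ≡ independent n (filter offDiag? I)
independent-filter-offDiag n I = ⇔→≡ (mk⇔
  (λ e → independent⁺ n _ λ u∈ v∈ →
    independent⁻ n I e (∈-filter⁻ offDiag? u∈ .proj₁) (∈-filter⁻ offDiag? v∈ .proj₁))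
  (λ e → independent⁺ n I (restrict e)))
  where
    restrict : independent n (filter offDiag? I) ≡ true → ∀ {u v} → u ∈ I → v ∈ I → adj n u v ≡ false
    restrict e {u} {v} u∈ v∈ with offDiag? u | offDiag? v
    ... | no ¬u | _ = adj-¬offDiag n v (¬T⇒≡false ¬u)
    ... | yes _ | no ¬v = trans (adj-sym n u v) (adj-¬offDiag n u (¬T⇒≡false ¬v))
    ... | yes u′ | yes v′ = independent⁻ n _ e (∈-filter⁺ offDiag? u∈ u′) (∈-filter⁺ offDiag? v∈ v′)

independent-++-column : ∀ {n p} A C → p ≤ n → All (OffDiagIn 0 p) A → All (InColumnBelow p n) C →
                        independent n (A ++ C) ≡ independent p A
independent-++-column {n} {p} A C p≤n offA colC = ⇔→≡ (mk⇔
  (λ e → independent⁺ p A λ u∈ v∈ →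
    trans (sym (restrict u∈ v∈)) (independent⁻ n (A ++ C) e (∈-++⁺ˡ u∈) (∈-++⁺ˡ v∈)))
  (λ e → independent⁺ n (A ++ C) λ u∈ v∈ → combine e (∈-++⁻ A u∈) (∈-++⁻ A v∈)))
  where
    restrict : ∀ {u v} → u ∈ A → v ∈ A → adj n u v ≡ adj p u v
    restrict {i , j} {k , l} u∈ v∈ with All.lookup offA u∈ | All.lookup offA v∈
    ... | _ , _ , _ , j≤p | _ , _ , _ , l≤p = adj-restrict {i = i} {k = k} j≤p l≤p p≤n
    across : ∀ {u v} → u ∈ A → v ∈ C → adj n u v ≡ false
    across {a , b} {q , l} u∈ v∈ with All.lookup offA u∈ | All.lookup colC v∈
    ... | _ , a<b , _ , b≤p | refl , p<q , q<n =
      adj-column<row n (ℕₚ.<⇒≤ a<b) (ℕₚ.≤-<-trans b≤p p<q) (ℕₚ.<⇒≤ q<n)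
    combine : independent p A ≡ true → ∀ {u v} → u ∈ A ⊎ u ∈ C → v ∈ A ⊎ v ∈ C → adj n u v ≡ false
    combine e (inj₁ u∈) (inj₁ v∈) = trans (restrict u∈ v∈) (independent⁻ p A e u∈ v∈)
    combine e (inj₁ u∈) (inj₂ v∈) = across u∈ v∈
    combine e {u} {v} (inj₂ u∈) (inj₁ v∈) = trans (adj-sym n u v) (across v∈ u∈)
    combine e {q , _} {q′ , _} (inj₂ u∈) (inj₂ v∈) with All.lookup colC u∈ | All.lookup colC v∈
    ... | refl , _ | refl , _ = adj-sameColumn n q q′ n

dependent-spanned : ∀ {n a b r} J → (a , b) ∈ J → (r , n) ∈ J → 1 ≤ a → a < b → r ≤ b → b < n →
                    independent n J ≡ false
dependent-spanned J ab∈ rn∈ 1≤a a<b r≤b b<n =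
  ¬-not (λ e → not-¬ (adj-spanned 1≤a a<b r≤b b<n) (independent⁻ _ J e ab∈ rn∈))

-- Labels of diagonal cells

elsewhereInColumn : ℕ → Cell → Bool
elsewhereInColumn i (k , l) = (l ≡ᵇ i) ∧ not (k ≡ᵇ i)

northEastOf : ℕ → Cell → Bool
northEastOf i (k , l) = (k ≤ᵇ i) ∧ (i <ᵇ l)

diagonalLabel : Bool → Bool → Label
diagonalLabel z s = if z then lz else if s then ls else lt

phi-diagonal : ∀ I i → phi I (i , i) ≡ diagonalLabel (any (elsewhereInColumn i) I) (any (northEastOf i) I)
phi-diagonal I i rewrite <ᵇ-irrefl i = refl

elsewhereInColumn-≢ : ∀ {i k l} → l ≢ i → elsewhereInColumn i (k , l) ≡ false
elsewhereInColumn-≢ {i} {k} l≢i = cong (_∧ not (k ≡ᵇ i)) (≢⇒≡ᵇ≡false l≢i)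

northEastOf-below : ∀ {i k l} → i < k → northEastOf i (k , l) ≡ false
northEastOf-below {i} {l = l} i<k = cong (_∧ (i <ᵇ l)) (<⇒≤ᵇ≡false i<k)

northEastOf-left : ∀ {i k l} → l ≤ i → northEastOf i (k , l) ≡ false
northEastOf-left {i} {k} l≤i = trans (cong ((k ≤ᵇ i) ∧_) (≤⇒<ᵇ≡false l≤i)) (∧-zeroʳ (k ≤ᵇ i))

phi-lz : ∀ {J i r} → (r , i) ∈ J → r ≢ i → phi J (i , i) ≡ lz
phi-lz {J} {i} {r} ri∈ r≢i = trans (phi-diagonal J i) (cong (λ z → diagonalLabel z (any (northEastOf i) J))
  (any-true⁺ {p = elsewhereInColumn i} ri∈ (cong₂ (λ a b → a ∧ not b) (≡ᵇ-refl i) (≢⇒≡ᵇ≡false r≢i))))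

phi-ls : ∀ {J i k l} → All (λ (_ , l′) → l′ ≢ i) J → (k , l) ∈ J → k ≤ i → i < l → phi J (i , i) ≡ ls
phi-ls {J} {i} notInColumn kl∈ k≤i i<l = trans (phi-diagonal J i) (cong₂ diagonalLabel
  (any-false⁺ {p = elsewhereInColumn i} λ {(k , _)} v∈ → elsewhereInColumn-≢ {k = k} (All.lookup notInColumn v∈))
  (any-true⁺ {p = northEastOf i} kl∈ (cong₂ _∧_ (≤⇒≤ᵇ≡true k≤i) (<⇒<ᵇ≡true i<l))))

phi-lt : ∀ {J i} → All (λ (_ , l) → l < i) J → phi J (i , i) ≡ lt
phi-lt {J} {i} leftOf = trans (phi-diagonal J i) (cong₂ diagonalLabel
  (any-false⁺ {p = elsewhereInColumn i} λ {(k , _)} v∈ →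
    elsewhereInColumn-≢ {k = k} (ℕₚ.<⇒≢ (All.lookup leftOf v∈)))
  (any-false⁺ {p = northEastOf i} λ {(k , _)} v∈ → northEastOf-left {k = k} (ℕₚ.<⇒≤ (All.lookup leftOf v∈))))

phi-diagonal-++-southEast : ∀ I {J i} → All (λ (k , l) → i < k × i < l) J → phi (I ++ J) (i , i) ≡ phi I (i , i)
phi-diagonal-++-southEast I {J} {i} southEast = begin
  phi (I ++ J) (i , i)
    ≡⟨ phi-diagonal (I ++ J) i ⟩
  diagonalLabel (any (elsewhereInColumn i) (I ++ J)) (any (northEastOf i) (I ++ J))
    ≡⟨ cong₂ diagonalLabel (any-++-false I elsewhere) (any-++-false I northEast) ⟩
  diagonalLabel (any (elsewhereInColumn i) I) (any (northEastOf i) I)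
    ≡⟨ phi-diagonal I i ⟨
  phi I (i , i) ∎
  where
    open ≡-Reasoning
    elsewhere : any (elsewhereInColumn i) J ≡ false
    elsewhere = any-false⁺ {p = elsewhereInColumn i} {xs = J} λ {(k , _)} v∈ →
      elsewhereInColumn-≢ {k = k} (ℕₚ.>⇒≢ (proj₂ (All.lookup southEast v∈)))
    northEast : any (northEastOf i) J ≡ false
    northEast = any-false⁺ {p = northEastOf i} {xs = J} λ {(_ , l)} v∈ →
      northEastOf-below {l = l} (proj₁ (All.lookup southEast v∈))

phi-diagonal-filter-offDiag : ∀ {I} → All Upper I → ∀ i → phi (filter offDiag? I) (i , i) ≡ phi I (i , i)
phi-diagonal-filter-offDiag {I} upper i = begin
  phi (filter offDiag? I) (i , i)
    ≡⟨ phi-diagonal (filter offDiag? I) i ⟩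
  diagonalLabel (any (elsewhereInColumn i) (filter offDiag? I)) (any (northEastOf i) (filter offDiag? I))
    ≡⟨ cong₂ diagonalLabel (any-filter offDiag? _ (All.map elsewhere upper))
                           (any-filter offDiag? _ (All.map northEast upper)) ⟩
  diagonalLabel (any (elsewhereInColumn i) I) (any (northEastOf i) I)
    ≡⟨ phi-diagonal I i ⟨
  phi I (i , i) ∎
  where
    open ≡-Reasoning
    elsewhere : ∀ {v} → Upper v → ¬ T (offDiag v) → elsewhereInColumn i v ≡ false
    elsewhere {k , _} k≤l ¬off with upper-¬offDiag⇒diagonal k≤l ¬off
    ... | refl = ∧-inverseʳ (k ≡ᵇ i)
    northEast : ∀ {v} → Upper v → ¬ T (offDiag v) → northEastOf i v ≡ false
    northEast {k , _} k≤l ¬off with upper-¬offDiag⇒diagonal k≤l ¬off | k ℕₚ.≤? i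
    ... | refl | yes k≤i = northEastOf-left {k = k} k≤i
    ... | refl | no k≰i = northEastOf-below {l = k} (ℕₚ.≰⇒> k≰i)

-- Sums over subsets

module SubsetSums {c ℓ : Level} (S : CommutativeSemiring c ℓ) where

  open CommutativeSemiring S
    renaming (refl to ≈-refl; sym to ≈-sym; trans to ≈-trans; reflexive to ≈-reflexive)
  open import Relation.Binary.Reasoning.Setoid setoid
  open import Algebra.Solver.Ring.NaturalCoefficients.Default S using (solve; _:=_; _:+_; _:*_; con)

  private variable A : Set

  ∑ : List Carrier → Carrier
  ∑ = foldr _+_ 0#

  ∏ : List Carrier → Carrier
  ∏ = foldr _*_ 1#

  ∑⊆ : List A → (List A → Carrier) → Carrier
  ∑⊆ L F = ∑ (map F (subsets L))

  syntax ∑⊆ L (λ I → F) = ∑[ I ⊆ L ] F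

  ∑-++ : ∀ xs ys → ∑ (xs ++ ys) ≈ ∑ xs + ∑ ys
  ∑-++ [] ys = ≈-sym (+-identityˡ _)
  ∑-++ (x ∷ xs) ys = ≈-trans (+-congˡ (∑-++ xs ys)) (≈-sym (+-assoc x _ _))

  ∑-upTo-suc : (f : ℕ → Carrier) (c : ℕ) → ∑ (map f (upTo (suc c))) ≈ ∑ (map f (upTo c)) + f c
  ∑-upTo-suc f c = begin
    ∑ (map f (upTo (suc c)))            ≡⟨ cong (∑ ∘ map f) (upTo-∷ʳ c) ⟨
    ∑ (map f (upTo c ++ c ∷ []))        ≡⟨ cong ∑ (map-++ f (upTo c) (c ∷ [])) ⟩
    ∑ (map f (upTo c) ++ f c ∷ [])      ≈⟨ ∑-++ (map f (upTo c)) (f c ∷ []) ⟩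
    ∑ (map f (upTo c)) + (f c + 0#)     ≈⟨ +-congˡ (+-identityʳ (f c)) ⟩
    ∑ (map f (upTo c)) + f c            ∎

  ∏-map-++ : (f : A → Carrier) → ∀ xs ys → ∏ (map f (xs ++ ys)) ≈ ∏ (map f xs) * ∏ (map f ys)
  ∏-map-++ f [] ys = ≈-sym (*-identityˡ _)
  ∏-map-++ f (x ∷ xs) ys = ≈-trans (*-congˡ (∏-map-++ f xs ys)) (≈-sym (*-assoc (f x) _ _))

  ∑-cong : {f g : A → Carrier} → ∀ xs → (∀ a → f a ≈ g a) → ∑ (map f xs) ≈ ∑ (map g xs)
  ∑-cong [] h = ≈-refl
  ∑-cong (x ∷ xs) h = +-cong (h x) (∑-cong xs h)

  ∏-congᴬ : {P : A → Set} {f g : A → Carrier} → ∀ {xs} → All P xs → (∀ {a} → P a → f a ≈ g a) →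
            ∏ (map f xs) ≈ ∏ (map g xs)
  ∏-congᴬ [] h = ≈-refl
  ∏-congᴬ (px ∷ pxs) h = *-cong (h px) (∏-congᴬ pxs h)

  ∑-+ : (f g : A → Carrier) → ∀ xs → ∑ (map (λ a → f a + g a) xs) ≈ ∑ (map f xs) + ∑ (map g xs)
  ∑-+ f g [] = ≈-sym (+-identityˡ 0#)
  ∑-+ f g (x ∷ xs) = ≈-trans (+-congˡ (∑-+ f g xs))
    (solve 4 (λ a b c d → (a :+ b) :+ (c :+ d) := (a :+ c) :+ (b :+ d)) ≈-refl
             (f x) (g x) (∑ (map f xs)) (∑ (map g xs)))

  ∑-*ˡ : (k : Carrier) (f : A → Carrier) → ∀ xs → ∑ (map (λ a → k * f a) xs) ≈ k * ∑ (map f xs)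
  ∑-*ˡ k f [] = ≈-sym (zeroʳ k)
  ∑-*ˡ k f (x ∷ xs) = ≈-trans (+-congˡ (∑-*ˡ k f xs)) (≈-sym (distribˡ k (f x) _))

  ∑-*ʳ : (k : Carrier) (f : A → Carrier) → ∀ xs → ∑ (map (λ a → f a * k) xs) ≈ ∑ (map f xs) * k
  ∑-*ʳ k f [] = ≈-sym (zeroˡ k)
  ∑-*ʳ k f (x ∷ xs) = ≈-trans (+-congˡ (∑-*ʳ k f xs)) (≈-sym (distribʳ k (f x) _))

  ∑-zero : (f : A → Carrier) → ∀ xs → (∀ a → f a ≈ 0#) → ∑ (map f xs) ≈ 0#
  ∑-zero f [] h = ≈-refl
  ∑-zero f (x ∷ xs) h = ≈-trans (+-cong (h x) (∑-zero f xs h)) (+-identityʳ 0#)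

  ∑⊆-∷ : (x : A) (L : List A) (F : List A → Carrier) → ∑⊆ (x ∷ L) F ≈ ∑⊆ L F + ∑[ I ⊆ L ] F (x ∷ I)
  ∑⊆-∷ x L F = begin
    ∑ (map F (subsets L ++ map (x ∷_) (subsets L)))        ≡⟨ cong ∑ (map-++ F (subsets L) _) ⟩
    ∑ (map F (subsets L) ++ map F (map (x ∷_) (subsets L))) ≈⟨ ∑-++ (map F (subsets L)) _ ⟩
    ∑⊆ L F + ∑ (map F (map (x ∷_) (subsets L)))            ≡⟨ cong (λ xs → ∑⊆ L F + ∑ xs) (map-∘ (subsets L)) ⟨
    ∑⊆ L F + ∑[ I ⊆ L ] F (x ∷ I)                          ∎

  ∑⊆-cong : (L : List A) {F G : List A → Carrier} → (∀ I → F I ≈ G I) → ∑⊆ L F ≈ ∑⊆ L G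
  ∑⊆-cong L h = ∑-cong (subsets L) h

  ∑⊆-congᴬ : {P : A → Set} {L : List A} {F G : List A → Carrier} → All P L →
             (∀ I → All P I → F I ≈ G I) → ∑⊆ L F ≈ ∑⊆ L G
  ∑⊆-congᴬ [] h = +-congʳ (h [] [])
  ∑⊆-congᴬ {L = x ∷ L} {F} {G} (px ∷ pL) h = begin
    ∑⊆ (x ∷ L) F                   ≈⟨ ∑⊆-∷ x L F ⟩
    ∑⊆ L F + ∑[ I ⊆ L ] F (x ∷ I)  ≈⟨ +-cong (∑⊆-congᴬ pL h) (∑⊆-congᴬ pL λ I pI → h (x ∷ I) (px ∷ pI)) ⟩
    ∑⊆ L G + ∑[ I ⊆ L ] G (x ∷ I)  ≈⟨ ∑⊆-∷ x L G ⟨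
    ∑⊆ (x ∷ L) G                   ∎

  ∑⊆-++ : (xs ys : List A) (F : List A → Carrier) → ∑⊆ (xs ++ ys) F ≈ ∑[ I ⊆ xs ] ∑[ J ⊆ ys ] F (I ++ J)
  ∑⊆-++ [] ys F = ≈-sym (+-identityʳ _)
  ∑⊆-++ (x ∷ xs) ys F = begin
    ∑⊆ (x ∷ xs ++ ys) F
      ≈⟨ ∑⊆-∷ x (xs ++ ys) F ⟩
    ∑⊆ (xs ++ ys) F + ∑[ I ⊆ xs ++ ys ] F (x ∷ I)
      ≈⟨ +-cong (∑⊆-++ xs ys F) (∑⊆-++ xs ys (λ I → F (x ∷ I))) ⟩
    ∑[ I ⊆ xs ] ∑[ J ⊆ ys ] F (I ++ J) + ∑[ I ⊆ xs ] ∑[ J ⊆ ys ] F (x ∷ I ++ J)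
      ≈⟨ ∑⊆-∷ x xs (λ I → ∑[ J ⊆ ys ] F (I ++ J)) ⟨
    ∑[ I ⊆ x ∷ xs ] ∑[ J ⊆ ys ] F (I ++ J) ∎

  ∑⊆-only-[] : {P : A → Set} {L : List A} (F : List A → Carrier) → All P L →
               (∀ {x} I → P x → F (x ∷ I) ≈ 0#) → ∑⊆ L F ≈ F []
  ∑⊆-only-[] F [] h = +-identityʳ (F [])
  ∑⊆-only-[] {L = x ∷ L} F (px ∷ pL) h = begin
    ∑⊆ (x ∷ L) F                   ≈⟨ ∑⊆-∷ x L F ⟩
    ∑⊆ L F + ∑[ I ⊆ L ] F (x ∷ I)  ≈⟨ +-cong (∑⊆-only-[] F pL h) (∑-zero _ (subsets L) (λ I → h I px)) ⟩
    F [] + 0#                      ≈⟨ +-identityʳ (F []) ⟩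
    F []                           ∎

  ∑⊆-∏ : (L : List A) (f : A → Carrier) → ∑[ D ⊆ L ] ∏ (map f D) ≈ ∏ (map (λ d → f d + 1#) L)
  ∑⊆-∏ [] f = +-identityʳ 1#
  ∑⊆-∏ (x ∷ L) f = begin
    ∑[ D ⊆ x ∷ L ] ∏ (map f D)
      ≈⟨ ∑⊆-∷ x L _ ⟩
    ∑[ D ⊆ L ] ∏ (map f D) + ∑[ D ⊆ L ] (f x * ∏ (map f D))
      ≈⟨ +-cong (∑⊆-∏ L f) (≈-trans (∑-*ˡ (f x) (λ D → ∏ (map f D)) (subsets L)) (*-congˡ (∑⊆-∏ L f))) ⟩
    P + f x * P
      ≈⟨ solve 2 (λ a b → a :+ (b :* a) := (b :+ con 1) :* a) ≈-refl P (f x) ⟩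
    (f x + 1#) * P ∎
    where P = ∏ (map (λ d → f d + 1#) L)

  module _ {p} {P : Pred A p} (P? : Decidable P) where

    private
      ¬P? : Decidable (∁ P)
      ¬P? = ∁? P?

      ¬P-accept : ∀ {x xs} → ¬ P x → filter ¬P? (x ∷ xs) ≡ x ∷ filter ¬P? xs
      ¬P-accept = filter-accept ¬P?

      ¬P-reject : ∀ {x xs} → P x → filter ¬P? (x ∷ xs) ≡ filter ¬P? xs
      ¬P-reject px = filter-reject ¬P? (λ ¬px → ¬px px)

    ∏-partition : (f : A → Carrier) (xs : List A) →
                  ∏ (map f xs) ≈ ∏ (map f (filter P? xs)) * ∏ (map f (filter ¬P? xs))
    ∏-partition f [] = ≈-sym (*-identityˡ 1#)
    ∏-partition f (x ∷ xs) = step (P? x)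
      where
        ∏ₚ = ∏ (map f (filter P? xs))
        ∏ₙ = ∏ (map f (filter ¬P? xs))
        RHS = ∏ (map f (filter P? (x ∷ xs))) * ∏ (map f (filter ¬P? (x ∷ xs)))
        reindex : ∀ {ys zs} → filter P? (x ∷ xs) ≡ ys → filter ¬P? (x ∷ xs) ≡ zs →
                  ∏ (map f ys) * ∏ (map f zs) ≈ RHS
        reindex refl refl = ≈-refl
        step : Dec (P x) → f x * ∏ (map f xs) ≈ RHS
        step (yes px) = begin
          f x * ∏ (map f xs)  ≈⟨ *-congˡ (∏-partition f xs) ⟩
          f x * (∏ₚ * ∏ₙ)     ≈⟨ *-assoc (f x) ∏ₚ ∏ₙ ⟨
          (f x * ∏ₚ) * ∏ₙ     ≈⟨ reindex (filter-accept P? px) (¬P-reject px) ⟩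
          RHS                 ∎
        step (no ¬px) = begin
          f x * ∏ (map f xs)  ≈⟨ *-congˡ (∏-partition f xs) ⟩
          f x * (∏ₚ * ∏ₙ)     ≈⟨ solve 3 (λ a b c → a :* (b :* c) := b :* (a :* c)) ≈-refl (f x) ∏ₚ ∏ₙ ⟩
          ∏ₚ * (f x * ∏ₙ)     ≈⟨ reindex (filter-reject P? ¬px) (¬P-accept ¬px) ⟩
          RHS                 ∎

    ∑⊆-partition : (L : List A) (K : List A → List A → Carrier) →
                   ∑[ I ⊆ L ] K (filter P? I) (filter ¬P? I) ≈ ∑[ J ⊆ filter P? L ] ∑[ D ⊆ filter ¬P? L ] K J D
    ∑⊆-partition [] K = ≈-sym (+-identityʳ _)
    ∑⊆-partition (x ∷ L) K = step (P? x)
      where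
        F = λ I → K (filter P? I) (filter ¬P? I)
        Lₚ = filter P? L
        Lₙ = filter ¬P? L
        RHS = ∑[ J ⊆ filter P? (x ∷ L) ] ∑[ D ⊆ filter ¬P? (x ∷ L) ] K J D
        reindex : ∀ {Lₚ′ Lₙ′} → filter P? (x ∷ L) ≡ Lₚ′ → filter ¬P? (x ∷ L) ≡ Lₙ′ →
                  ∑[ J ⊆ Lₚ′ ] ∑[ D ⊆ Lₙ′ ] K J D ≈ RHS
        reindex refl refl = ≈-refl
        step : Dec (P x) → ∑⊆ (x ∷ L) F ≈ RHS
        step (yes px) = begin
          ∑⊆ (x ∷ L) F
            ≈⟨ ∑⊆-∷ x L F ⟩
          ∑⊆ L F + ∑[ I ⊆ L ] F (x ∷ I)
            ≈⟨ +-congˡ (∑⊆-cong L λ I → ≈-reflexive (cong₂ K (filter-accept P? px) (¬P-reject px))) ⟩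
          ∑⊆ L F + ∑[ I ⊆ L ] K (x ∷ filter P? I) (filter ¬P? I)
            ≈⟨ +-cong (∑⊆-partition L K) (∑⊆-partition L (λ J → K (x ∷ J))) ⟩
          ∑[ J ⊆ Lₚ ] ∑[ D ⊆ Lₙ ] K J D + ∑[ J ⊆ Lₚ ] ∑[ D ⊆ Lₙ ] K (x ∷ J) D
            ≈⟨ ∑⊆-∷ x Lₚ _ ⟨
          ∑[ J ⊆ x ∷ Lₚ ] ∑[ D ⊆ Lₙ ] K J D
            ≈⟨ reindex (filter-accept P? px) (¬P-reject px) ⟩
          RHS ∎
        step (no ¬px) = begin
          ∑⊆ (x ∷ L) F
            ≈⟨ ∑⊆-∷ x L F ⟩
          ∑⊆ L F + ∑[ I ⊆ L ] F (x ∷ I)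
            ≈⟨ +-congˡ (∑⊆-cong L λ I → ≈-reflexive (cong₂ K (filter-reject P? ¬px) (¬P-accept ¬px))) ⟩
          ∑⊆ L F + ∑[ I ⊆ L ] K (filter P? I) (x ∷ filter ¬P? I)
            ≈⟨ +-cong (∑⊆-partition L K) (∑⊆-partition L (λ J D → K J (x ∷ D))) ⟩
          ∑[ J ⊆ Lₚ ] ∑[ D ⊆ Lₙ ] K J D + ∑[ J ⊆ Lₚ ] ∑[ D ⊆ Lₙ ] K J (x ∷ D)
            ≈⟨ ∑-+ (λ J → ∑[ D ⊆ Lₙ ] K J D) (λ J → ∑[ D ⊆ Lₙ ] K J (x ∷ D)) (subsets Lₚ) ⟨
          ∑[ J ⊆ Lₚ ] (∑[ D ⊆ Lₙ ] K J D + ∑[ D ⊆ Lₙ ] K J (x ∷ D))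
            ≈⟨ ∑⊆-cong Lₚ (λ J → ∑⊆-∷ x Lₙ (K J)) ⟨
          ∑[ J ⊆ Lₚ ] ∑[ D ⊆ x ∷ Lₙ ] K J D
            ≈⟨ reindex (filter-reject P? ¬px) (¬P-accept ¬px) ⟩
          RHS ∎

-- The recurrence

module Recurrence {c ℓ : Level} (S : CommutativeSemiring c ℓ) (y z s t : CommutativeSemiring.Carrier S) where

  open CommutativeSemiring S
    renaming (refl to ≈-refl; sym to ≈-sym; trans to ≈-trans; reflexive to ≈-reflexive)
  open GF S y z s t
  open SubsetSums S
  open import Relation.Binary.Reasoning.Setoid setoid
  open import Algebra.Solver.Ring.NaturalCoefficients.Default S using (solve; _:=_; _:*_)

  pow-* : ∀ a b k → pow (a * b) k ≈ pow a k * pow b k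
  pow-* a b zero = ≈-sym (*-identityˡ 1#)
  pow-* a b (suc k) = ≈-trans (*-congˡ (pow-* a b k))
    (solve 4 (λ a b p q → (a :* b) :* (p :* q) := (a :* p) :* (b :* q)) ≈-refl a b (pow a k) (pow b k))

  ∏-colCells-const : ∀ a r k j → ∏ (map (λ _ → a) (colCells r k j)) ≈ pow a k
  ∏-colCells-const a r zero j = ≈-refl
  ∏-colCells-const a r (suc k) j = *-congˡ (∏-colCells-const a (suc r) k j)

  ∏-diagFrom-cong : ∀ {f g : Cell → Carrier} a d → (∀ {i} → a ≤ i → i < a +ℕ d → f (i , i) ≈ g (i , i)) →
                    ∏ (map f (diagFrom a d)) ≈ ∏ (map g (diagFrom a d))
  ∏-diagFrom-cong a zero h = ≈-refl
  ∏-diagFrom-cong a (suc d) h =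
    *-cong (h ℕₚ.≤-refl (ℕₚ.m<m+n a (s≤s z≤n))) (∏-diagFrom-cong (suc a) d (interval-tail a d h))

  ∏-diagFrom-∷ʳ : ∀ (f : Cell → Carrier) {k k′} a d → (∀ {i} → a ≤ i → i < a +ℕ d → f (i , i) ≈ k) →
                  f (a +ℕ d , a +ℕ d) ≈ k′ → ∏ (map f (diagFrom a (suc d))) ≈ pow k d * k′
  ∏-diagFrom-∷ʳ f a zero _ last rewrite ℕₚ.+-identityʳ a =
    ≈-trans (*-identityʳ _) (≈-trans last (≈-sym (*-identityˡ _)))
  ∏-diagFrom-∷ʳ f {k′ = k′} a (suc d) inner last = ≈-trans
    (*-cong (inner ℕₚ.≤-refl (ℕₚ.m<m+n a (s≤s z≤n)))
            (∏-diagFrom-∷ʳ f (suc a) d (interval-tail a d inner)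
                                       (subst (λ x → f (x , x) ≈ k′) (ℕₚ.+-suc a d) last)))
    (≈-sym (*-assoc _ _ _))

  yWeight : List Cell → Carrier
  yWeight J = ∏ (map (λ _ → y) J)

  indicatorWeight : ℕ → List Cell → Carrier
  indicatorWeight n J = if independent n J then yWeight J else 0#

  -- summing over the diagonal cells that may be added to J: each contributes its label + 1
  diagonalFactor : ℕ → List Cell → Carrier
  diagonalFactor n J = ∏ (map (λ d → val (phi J d) + 1#) (diagCells n))

  offWeight : ℕ → List Cell → Carrier
  offWeight n J = indicatorWeight n J * diagonalFactor n J

  Q : ℕ → Carrier
  Q n = ∑[ J ⊆ offDiagCells n ] offWeight n J

  weight-partition : ∀ {I} → All Upper I →
    weight I ≈ yWeight (filter offDiag? I) * ∏ (map (λ d → val (phi (filter offDiag? I) d)) (filter onDiag? I))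
  weight-partition {I} upper = ≈-trans (∏-partition offDiag? (λ v → val (phi I v)) I)
    (*-cong (∏-congᴬ (Allₚ.all-filter offDiag? I) (λ {v} → offDiagonal {v}))
            (∏-congᴬ (All.zip (Allₚ.all-filter onDiag? I , Allₚ.filter⁺ onDiag? upper)) (λ {v} → diagonal {v})))
    where
      offDiagonal : ∀ {v} → T (offDiag v) → val (phi I v) ≈ y
      offDiagonal {i , j} i<j rewrite T⇒≡true i<j = ≈-refl
      diagonal : ∀ {v} → ¬ T (offDiag v) × Upper v → val (phi I v) ≈ val (phi (filter offDiag? I) v)
      diagonal {i , _} (¬off , i≤j) with upper-¬offDiag⇒diagonal i≤j ¬off
      ... | refl = ≈-reflexive (cong val (sym (phi-diagonal-filter-offDiag upper i)))

  Rn≈Q : ∀ n → Rn n ≈ Q n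
  Rn≈Q n = begin
    Rn n
      ≈⟨ ∑⊆-congᴬ (cells-Upper n) (λ I → split) ⟩
    ∑[ I ⊆ cells n ] K (filter offDiag? I) (filter onDiag? I)
      ≈⟨ ∑⊆-partition offDiag? (cells n) K ⟩
    ∑[ J ⊆ filter offDiag? (cells n) ] ∑[ D ⊆ filter onDiag? (cells n) ] K J D
      ≡⟨ cong₂ (λ Lₒ L₋ → ∑[ J ⊆ Lₒ ] ∑[ D ⊆ L₋ ] K J D) (filter-offDiag-cells n) (filter-onDiag-cells n) ⟩
    ∑[ J ⊆ offDiagCells n ] ∑[ D ⊆ diagCells n ] K J D
      ≈⟨ ∑⊆-cong (offDiagCells n) (λ J → ≈-trans (∑-*ˡ (indicatorWeight n J) _ (subsets (diagCells n)))
                                                 (*-congˡ (∑⊆-∏ (diagCells n) (λ d → val (phi J d))))) ⟩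
    Q n ∎
    where
      K : List Cell → List Cell → Carrier
      K J D = indicatorWeight n J * ∏ (map (λ d → val (phi J d)) D)
      split : ∀ {I} → All Upper I →
              (if independent n I then weight I else 0#) ≈ K (filter offDiag? I) (filter onDiag? I)
      split {I} upper rewrite independent-filter-offDiag n I with independent n (filter offDiag? I)
      ... | true = weight-partition upper
      ... | false = ≈-sym (zeroˡ _)

  indicatorWeight-++-column : ∀ {n p} A C → p ≤ n → All (OffDiagIn 0 p) A → All (InColumnBelow p n) C →
                              indicatorWeight n (A ++ C) ≈ indicatorWeight p A * yWeight C
  indicatorWeight-++-column {n} {p} A C p≤n offA colC rewrite independent-++-column A C p≤n offA colC
    with independent p A
  ... | true = ∏-map-++ (λ _ → y) A C
  ... | false = ≈-sym (zeroˡ _)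

  offWeight-dependent : ∀ n J → independent n J ≡ false → offWeight n J ≈ 0#
  offWeight-dependent n J e rewrite e = zeroˡ _

  κ ρ : Carrier
  κ = (y * (s + 1#)) * (z + 1#)
  ρ = (s + 1#) * (y + 1#)

  -- the sets whose cells in the last column lie in the rows r, …, r + k − 1
  columnSum : ℕ → ℕ → ℕ → Carrier
  columnSum m r k = ∑[ A ⊆ offDiagCells m ] ∑[ B ⊆ colCells r k (suc m) ] offWeight (suc m) (A ++ B)

  -- … and contain (r , m + 1)
  topSum : ℕ → ℕ → ℕ → Carrier
  topSum m r k =
    ∑[ A ⊆ offDiagCells m ] ∑[ B ⊆ colCells (suc r) k (suc m) ] offWeight (suc m) (A ++ (r , suc m) ∷ B)

  columnSum-peel : ∀ m r k → columnSum m r (suc k) ≈ columnSum m (suc r) k + topSum m r k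
  columnSum-peel m r k = ≈-trans
    (∑⊆-cong (offDiagCells m) (λ A → ∑⊆-∷ (r , suc m) (colCells (suc r) k (suc m)) _))
    (∑-+ _ _ (subsets (offDiagCells m)))

  offWeight-suc : ∀ m A → All (OffDiagIn 0 m) A → offWeight (suc m) A ≈ offWeight m A * (t + 1#)
  offWeight-suc m A offA = begin
    indicatorWeight (suc m) A * diagonalFactor (suc m) A   ≈⟨ *-cong indicator diagonal ⟩
    indicatorWeight m A * (diagonalFactor m A * (t + 1#))  ≈⟨ *-assoc _ _ _ ⟨
    offWeight m A * (t + 1#)                               ∎
    where
      indicator : indicatorWeight (suc m) A ≈ indicatorWeight m A
      indicator = ≈-trans (≈-reflexive (cong (indicatorWeight (suc m)) (sym (++-identityʳ A))))
                          (≈-trans (indicatorWeight-++-column A [] (ℕₚ.n≤1+n m) offA []) (*-identityʳ _))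
      f : Cell → Carrier
      f d = val (phi A d) + 1#
      leftOf : All (λ (_ , l) → l < suc m) A
      leftOf = All.map (λ (_ , _ , _ , b≤m) → s≤s b≤m) offA
      diagonal : diagonalFactor (suc m) A ≈ diagonalFactor m A * (t + 1#)
      diagonal = begin
        ∏ (map f (diagCells (suc m)))                      ≡⟨ cong (∏ ∘ map f) (diagCells-∷ʳ m) ⟩
        ∏ (map f (diagCells m ++ (suc m , suc m) ∷ []))    ≈⟨ ∏-map-++ f (diagCells m) _ ⟩
        diagonalFactor m A * (f (suc m , suc m) * 1#)      ≈⟨ *-congˡ (*-identityʳ _) ⟩
        diagonalFactor m A * f (suc m , suc m)             ≈⟨ *-congˡ (+-congʳ (≈-reflexive (cong val (phi-lt leftOf)))) ⟩
        diagonalFactor m A * (t + 1#)                      ∎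

  columnSum-empty : ∀ m → columnSum m (suc m) 0 ≈ (1# + t) * Q m
  columnSum-empty m = begin
    columnSum m (suc m) 0
      ≈⟨ ∑⊆-congᴬ (offDiagBetween-All 0 m) (λ A offA → ≈-trans (+-identityʳ _) (last-column-empty A offA)) ⟩
    ∑[ A ⊆ offDiagCells m ] (offWeight m A * (t + 1#))
      ≈⟨ ∑-*ʳ (t + 1#) (offWeight m) (subsets (offDiagCells m)) ⟩
    Q m * (t + 1#)
      ≈⟨ *-comm (Q m) (t + 1#) ⟩
    (t + 1#) * Q m
      ≈⟨ *-congʳ (+-comm t 1#) ⟩
    (1# + t) * Q m ∎
    where
      last-column-empty : ∀ A → All (OffDiagIn 0 m) A → offWeight (suc m) (A ++ []) ≈ offWeight m A * (t + 1#)
      last-column-empty A offA rewrite ++-identityʳ A = offWeight-suc m A offA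

  -- n = p + k + 2, and the topmost cell of J in the last column is (p + 1 , n)
  module TopCell (p k : ℕ) where

    m n : ℕ
    m = p +ℕ suc k
    n = suc m

    σ : Carrier
    σ = pow (s + 1#) (suc k) * (z + 1#)

    1+p<n : suc p < n
    1+p<n = s≤s (subst (suc p ≤_) (sym (ℕₚ.+-suc p k)) (s≤s (ℕₚ.m≤m+n p k)))

    top-InColumn : InColumnBelow p n (suc p , n)
    top-InColumn = refl , ℕₚ.≤-refl , 1+p<n

    below : List Cell
    below = colCells (suc (suc p)) k n

    below-InColumn : All (InColumnBelow p n) below
    below-InColumn = colCells-All (suc (suc p)) k n λ {q} p+2≤q q< →
      refl , ℕₚ.<⇒≤ p+2≤q , subst (q <_) (cong suc (sym (ℕₚ.+-suc p k))) q<

    module _ (A B : List Cell) (offA : All (OffDiagIn 0 p) A) (colB : All (InColumnBelow p n) B) where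

      J : List Cell
      J = A ++ (suc p , n) ∷ B

      top∈J : (suc p , n) ∈ J
      top∈J = ∈-++⁺ʳ A (here refl)

      phi-J-unchanged : ∀ {i} → i ≤ p → phi J (i , i) ≡ phi A (i , i)
      phi-J-unchanged {i} i≤p = phi-diagonal-++-southEast A (All.map southEast (top-InColumn ∷ colB))
        where
          southEast : ∀ {v} → InColumnBelow p n v → i < proj₁ v × i < proj₂ v
          southEast {_ , _} (refl , p<q , q<n) = ℕₚ.≤-<-trans i≤p p<q , ℕₚ.≤-<-trans i≤p (ℕₚ.<-trans p<q q<n)

      phi-J-between : ∀ {i} → suc p ≤ i → i < n → phi J (i , i) ≡ ls
      phi-J-between {i} p<i i<n =
        phi-ls (Allₚ.++⁺ (All.map leftColumns offA) (All.map lastColumn (top-InColumn ∷ colB))) top∈J p<i i<n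
        where
          leftColumns : ∀ {v} → OffDiagIn 0 p v → proj₂ v ≢ i
          leftColumns (_ , _ , _ , b≤p) = ℕₚ.<⇒≢ (ℕₚ.≤-<-trans b≤p p<i)
          lastColumn : ∀ {v} → InColumnBelow p n v → proj₂ v ≢ i
          lastColumn {_ , _} (refl , _) n≡i = ℕₚ.<⇒≢ i<n (sym n≡i)

      phi-J-last : phi J (n , n) ≡ lz
      phi-J-last = phi-lz top∈J (ℕₚ.<⇒≢ 1+p<n)

      diagonalFactor-topCell : diagonalFactor n J ≈ diagonalFactor p A * σ
      diagonalFactor-topCell = begin
        ∏ (map f (diagFrom 1 n))
          ≡⟨ cong (∏ ∘ map f) (trans (cong (diagFrom 1) (sym (ℕₚ.+-suc p (suc k))))
                                     (diagFrom-++ 1 p (suc (suc k)))) ⟩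
        ∏ (map f (diagFrom 1 p ++ diagFrom (suc p) (suc (suc k))))
          ≈⟨ ∏-map-++ f (diagFrom 1 p) _ ⟩
        ∏ (map f (diagFrom 1 p)) * ∏ (map f (diagFrom (suc p) (suc (suc k))))
          ≈⟨ *-cong (∏-diagFrom-cong 1 p λ {i} _ i<1+p → label i (phi-J-unchanged (ℕₚ.≤-pred i<1+p)))
                    (∏-diagFrom-∷ʳ f (suc p) (suc k) (λ {i} p<i i<n → label i (phi-J-between p<i i<n))
                                                     (label n phi-J-last)) ⟩
        diagonalFactor p A * σ ∎
        where
          f : Cell → Carrier
          f d = val (phi J d) + 1#
          label : ∀ i {a} → phi J (i , i) ≡ a → f (i , i) ≈ val a + 1#
          label _ e = +-congʳ (≈-reflexive (cong val e))

      offWeight-topCell : offWeight n J ≈ (offWeight p A * (y * σ)) * yWeight B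
      offWeight-topCell = begin
        indicatorWeight n J * diagonalFactor n J
          ≈⟨ *-cong (indicatorWeight-++-column A _ p≤n offA (top-InColumn ∷ colB)) diagonalFactor-topCell ⟩
        (indicatorWeight p A * (y * yWeight B)) * (diagonalFactor p A * σ)
          ≈⟨ solve 5 (λ w y′ b d σ′ → (w :* (y′ :* b)) :* (d :* σ′) := ((w :* d) :* (y′ :* σ′)) :* b) ≈-refl
                     (indicatorWeight p A) y (yWeight B) (diagonalFactor p A) σ ⟩
        (offWeight p A * (y * σ)) * yWeight B ∎
        where p≤n = ℕₚ.<⇒≤ (ℕₚ.<-trans (ℕₚ.n<1+n p) 1+p<n)

    topSum-closed : topSum m (suc p) k ≈ κ * (pow ρ k * Q p)
    topSum-closed = begin
      topSum m (suc p) k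
        ≡⟨ cong (λ L → ∑⊆ L U) (offDiagBetween-++ p (suc k)) ⟩
      ∑⊆ (offDiagCells p ++ offDiagBetween p (suc k)) U
        ≈⟨ ∑⊆-++ (offDiagCells p) (offDiagBetween p (suc k)) U ⟩
      ∑[ A ⊆ offDiagCells p ] ∑[ A′ ⊆ offDiagBetween p (suc k) ] U (A ++ A′)
        ≈⟨ ∑⊆-cong (offDiagCells p) (λ A → ∑⊆-only-[] _ (offDiagBetween-All p (suc k)) (spanned A)) ⟩
      ∑[ A ⊆ offDiagCells p ] U (A ++ [])
        ≈⟨ ∑⊆-congᴬ (offDiagBetween-All 0 p) U-closed ⟩
      ∑[ A ⊆ offDiagCells p ] (offWeight p A * τ)
        ≈⟨ ∑-*ʳ τ (offWeight p) (subsets (offDiagCells p)) ⟩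
      Q p * τ
        ≈⟨ solve 6 (λ q y′ a a^k b b^k → q :* ((y′ :* ((a :* a^k) :* b)) :* b^k)
                                         := ((y′ :* a) :* b) :* ((a^k :* b^k) :* q)) ≈-refl
                   (Q p) y (s + 1#) (pow (s + 1#) k) (z + 1#) (pow (y + 1#) k) ⟩
      κ * ((pow (s + 1#) k * pow (y + 1#) k) * Q p)
        ≈⟨ *-congˡ (*-congʳ (pow-* (s + 1#) (y + 1#) k)) ⟨
      κ * (pow ρ k * Q p) ∎
      where
        τ = (y * σ) * pow (y + 1#) k
        U : List Cell → Carrier
        U A = ∑[ B ⊆ below ] offWeight n (A ++ (suc p , n) ∷ B)
        spanned : ∀ A {x} A′ → OffDiagIn p m x → U (A ++ x ∷ A′) ≈ 0#
        spanned A {a , b} A′ (1≤a , a<b , p<b , b≤m) = ∑-zero _ (subsets below) λ B →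
          offWeight-dependent n ((A ++ (a , b) ∷ A′) ++ (suc p , n) ∷ B)
            (dependent-spanned _ (∈-++⁺ˡ (∈-++⁺ʳ A (here refl))) (∈-++⁺ʳ _ (here refl)) 1≤a a<b p<b (s≤s b≤m))
        U-closed : ∀ A → All (OffDiagIn 0 p) A → U (A ++ []) ≈ offWeight p A * τ
        U-closed A offA rewrite ++-identityʳ A = begin
          ∑[ B ⊆ below ] offWeight n (A ++ (suc p , n) ∷ B)
            ≈⟨ ∑⊆-congᴬ below-InColumn (λ B colB → offWeight-topCell A B offA colB) ⟩
          ∑[ B ⊆ below ] ((offWeight p A * (y * σ)) * yWeight B)
            ≈⟨ ∑-*ˡ (offWeight p A * (y * σ)) yWeight (subsets below) ⟩
          (offWeight p A * (y * σ)) * ∑[ B ⊆ below ] yWeight B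
            ≈⟨ *-congˡ (≈-trans (∑⊆-∏ below (λ _ → y)) (∏-colCells-const (y + 1#) (suc (suc p)) k n)) ⟩
          (offWeight p A * (y * σ)) * pow (y + 1#) k
            ≈⟨ *-assoc _ _ _ ⟩
          offWeight p A * τ ∎

  topTerm : ℕ → ℕ → Carrier
  topTerm m i = κ * (pow ρ i * Q (m ∸ suc i))

  topSum≈topTerm : ∀ m p k → p +ℕ suc k ≡ m → topSum m (suc p) k ≈ topTerm m k
  topSum≈topTerm .(p +ℕ suc k) p k refl = ≈-trans (TopCell.topSum-closed p k)
    (≈-reflexive (cong (λ q → κ * (pow ρ k * Q q)) (sym (ℕₚ.m+n∸n≡m p (suc k)))))

  columnSum-unfold : ∀ m p k → p +ℕ k ≡ m →
                     columnSum m (suc p) k ≈ columnSum m (suc m) 0 + ∑ (map (topTerm m) (upTo k))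
  columnSum-unfold m p zero e with trans (sym (ℕₚ.+-identityʳ p)) e
  ... | refl = ≈-sym (+-identityʳ _)
  columnSum-unfold m p (suc k) e = begin
    columnSum m (suc p) (suc k)
      ≈⟨ columnSum-peel m (suc p) k ⟩
    columnSum m (suc (suc p)) k + topSum m (suc p) k
      ≈⟨ +-cong (columnSum-unfold m (suc p) k (trans (sym (ℕₚ.+-suc p k)) e)) (topSum≈topTerm m p k e) ⟩
    (columnSum m (suc m) 0 + ∑ (map (topTerm m) (upTo k))) + topTerm m k
      ≈⟨ +-assoc _ _ _ ⟩
    columnSum m (suc m) 0 + (∑ (map (topTerm m) (upTo k)) + topTerm m k)
      ≈⟨ +-congˡ (∑-upTo-suc (topTerm m) k) ⟨
    columnSum m (suc m) 0 + ∑ (map (topTerm m) (upTo (suc k))) ∎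

proposition9p4 : {c ℓ : Level} (S : CommutativeSemiring c ℓ) (y z s t : CommutativeSemiring.Carrier S) (n : ℕ) →
    CommutativeSemiring._≈_ S (GF.Rn S y z s t n) (GF.rhsCoeff S y z s t n)
proposition9p4 S y z s t = Rn≈rhsCoeff
  where
    open CommutativeSemiring S using (_≈_; _+_; _*_; 1#; setoid; +-cong; +-identityʳ; *-congˡ)
      renaming (sym to ≈-sym; trans to ≈-trans)
    open GF S y z s t
    open SubsetSums S
    open Recurrence S y z s t
    open import Relation.Binary.Reasoning.Setoid setoid

    Rn≈rhsCoeff : ∀ n → Rn n ≈ rhsCoeff n
    Rn≈rhsCoeff zero = +-identityʳ 1#
    Rn≈rhsCoeff (suc m) = begin
      Rn (suc m)
        ≈⟨ Rn≈Q (suc m) ⟩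
      Q (suc m)
        ≈⟨ ∑⊆-++ (offDiagCells m) (colCells 1 m (suc m)) (offWeight (suc m)) ⟩
      columnSum m 1 m
        ≈⟨ columnSum-unfold m 0 m refl ⟩
      columnSum m (suc m) 0 + ∑ (map (topTerm m) (upTo m))
        ≈⟨ +-cong (≈-trans (columnSum-empty m) (*-congˡ (≈-sym (Rn≈Q m))))
                  (∑-cong (upTo m) λ i → *-congˡ (*-congˡ (≈-sym (Rn≈Q (m ∸ suc i))))) ⟩
      (1# + t) * Rn m + ∑ (map (λ i → κ * (pow ρ i * Rn (m ∸ suc i))) (upTo m))
        ≡⟨ cong ((1# + t) * Rn m +_) (cong ∑ (map-∘ (upTo m))) ⟩
      rhsCoeff (suc m) ∎
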